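{- For every integer $d \ge 4$, \[ p^2(d) \ge \begin{cases} (k^2+1)(k+1) & \text{if } d = 3k, \\ (k^2+k+1)(k+1) & \text{if } d = 3k+1, \\ (k^2+k+1)(k+2) & \text{if } d = 3k+2, \end{cases} \] where $k$ is a positive integer. In particular, $p^2(d) > p_{\mathrm{bas}}^2(d)$.
   Context: $Q_n$ denotes the $n$-dimensional hypercube, with vertex set $\{0,1\}^n$. For $0\le \ell\le n$, an $\ell$-dimensional face (an embedded $Q_\ell$) of $Q_n$ is identified with a string in $\{0,1,\ast\}^n$ containing exactly $\ell$ symbols $\ast$; its vertices are the strings obtained by replacing each $\ast$ by $0$ or $1$. For $\ell \ge 0$, a $Q_\ell$-coloring of $Q_n$ is a coloring of all $\ell$-dimensional faces of $Q_n$ with $r \ge 1$ colors. For $d \ge \ell$, such a coloring is $d$-polychromatic if every $d$-dimensional face of $Q_n$ contains, among its $\ell$-dimensional subfaces, faces of all $r$ colors. For $d \ge \ell \ge 1$, $p^\ell(d)$ denotes the maximum $r$ such that for every $n \ge d$ the hypercube $Q_n$ admits a $d$-polychromatic $Q_\ell$-coloring with $r$ colors. For $d,\ell\ge 1$, let $0<r\le \ell+1$ be such that $r \equiv d+1 \pmod{\ell+1}$, and define $p_{\mathrm{bas}}^\ell(d) = \lceil \frac{d+1}{\ell+1}\rceil^{r}\lfloor \frac{d+1}{\ell+1}\rfloor^{\ell+1-r}$. -}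

module Defs where

open import Data.Nat using (ℕ; zero; suc; _+_; _*_; _^_; _≤_; _<_; _∸_)
open import Data.Nat.DivMod using (_/_; _%_)
open import Data.Fin using (Fin)
open import Data.Vec using (Vec; []; _∷_)
open import Data.Product using (Σ; ∃; _×_)
open import Relation.Binary.PropositionalEquality using (_≡_)

data Sym : Set where
  𝟘 𝟙 ⋆ : Sym

-- A face of Q_n is a string in {0,1,∗}^n.
Face : ℕ → Set
Face n = Vec Sym n

dim : ∀ {n} → Face n → ℕ
dim []       = 0
dim (⋆ ∷ f)  = suc (dim f)
dim (𝟘 ∷ f)  = dim f
dim (𝟙 ∷ f)  = dim f

data _⊑ₛ_ : Sym → Sym → Set where
  ⊑-𝟘 : 𝟘 ⊑ₛ 𝟘
  ⊑-𝟙 : 𝟙 ⊑ₛ 𝟙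
  ⊑-⋆ : ∀ {s} → s ⊑ₛ ⋆

-- G ⊑ F : G is a subface of F (vertex set of G contained in that of F).
data _⊑_ : ∀ {n} → Face n → Face n → Set where
  []  : [] ⊑ []
  _∷_ : ∀ {n s t} {g f : Face n} → s ⊑ₛ t → g ⊑ f → (s ∷ g) ⊑ (t ∷ f)

Face[_] : ℕ → ℕ → Set
Face[ ℓ ] n = Σ (Face n) (λ f → dim f ≡ ℓ)

Coloring : (ℓ n r : ℕ) → Set
Coloring ℓ n r = Face[ ℓ ] n → Fin r

Polychromatic : (ℓ d : ℕ) {n r : ℕ} → Coloring ℓ n r → Set
Polychromatic ℓ d {n} {r} c =
  (F : Face n) → dim F ≡ d → (col : Fin r) →
  Σ (Face[ ℓ ] n) (λ G → (Σ.proj₁ G ⊑ F) × (c G ≡ col))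

-- r is admissible for (ℓ,d): for every n ≥ d, Q_n admits a d-polychromatic
-- Q_ℓ-coloring with r colors.  p^ℓ(d) is the maximum admissible r.
Admissible : (ℓ d r : ℕ) → Set
Admissible ℓ d r = (n : ℕ) → d ≤ n → Σ (Coloring ℓ n r) (Polychromatic ℓ d)

-- "p^ℓ(d) ≥ m": some admissible r is ≥ m (equivalently, since p^ℓ(d) is the max).
pAtLeast : (ℓ d m : ℕ) → Set
pAtLeast ℓ d m = ∃ λ r → m ≤ r × Admissible ℓ d r

pGreater : (ℓ d m : ℕ) → Set
pGreater ℓ d m = ∃ λ r → m < r × Admissible ℓ d r

-- p_bas^ℓ(d); here r = d mod (ℓ+1) + 1 ∈ {1,…,ℓ+1} satisfies r ≡ d+1 (mod ℓ+1).
pbas : (ℓ d : ℕ) → ℕ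
pbas ℓ d = (((d + 1) + ℓ) / suc ℓ) ^ r * ((d + 1) / suc ℓ) ^ (suc ℓ ∸ r)
  where r = d % suc ℓ + 1

boundAux : ℕ → ℕ → ℕ
boundAux k 0             = (k * k + 1) * (k + 1)
boundAux k 1             = (k * k + k + 1) * (k + 1)
boundAux k (suc (suc _)) = (k * k + k + 1) * (k + 2)

bound : ℕ → ℕ
bound d = boundAux (d / 3) (d % 3)

-- Fix k ≥ 1, y ≥ 0 and q ≥ max(k + 1, y + 2); put Q = k(y + 2) + 1, m = k(y + 1) + 1 and
-- d = k + y + q + 1.  Colour a 2-face G by (ψ G mod Q, |G|₁ mod q), where ψ G = (k + 1) b₀ + m b₁ and
-- b₀, b₁ count the coordinates of G fixed to 1 before its first and its second star.  In a d-face F,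
-- let the stars of G be stars i < j of F, and let X of the i free coordinates before them, Y of the
-- j − i − 1 between them and Z of the d − j − 1 after them be set to 1.  As m ≡ −k (mod Q), ψ G is a
-- fixed offset plus X − kY, so these subfaces realise i + 1 + k(j − i − 1) consecutive residues.
-- We use i ∈ {k − 1, k} and j ∈ {k + y + 1, k + y + 2}.  For j = k + y + 1 the q − 1 coordinates after
-- the stars reach every number of ones mod q, and the two intervals have lengths Q − 1 and Q − k.
-- For j = k + y + 2 each interval is everything, but only q − 2 coordinates remain after the stars.
-- When both layouts with j = k + y + 1 miss, the offsets of the other two differ by some t ∈ [1, k];
-- this yields two subfaces of the right first coordinate whose X + Y differ by an amount strictly
-- between 0 and q, and one of them can be completed.
-- Taking (k, y, q) = (K, K − 2, K + 1), (K, K − 1, K + 1), (K, K − 1, K + 2) gives the three bounds.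

module Submission where

open import Defs
open import Data.Nat using (ℕ; zero; suc; pred; _+_; _*_; _∸_; _^_; _≤_; _<_; z≤n; s≤s; z<s; s<s; NonZero; _≤?_)
open import Data.Nat.Properties
import Data.Nat.DivMod as ℕ using (_mod_)
open import Data.Nat.DivMod
  using (_/_; _%_; +-distrib-/; m<n⇒m/n≡0; m*n/n≡m; m*n%n≡0; m%n<n; m≡m%n+[m/n]*n; [m+kn]%n≡m%n; m<n⇒m%n≡m)
open import Data.Nat.Tactic.RingSolver using (solve-∀)
open import Data.Fin using (Fin; toℕ; combine; remQuot)
open import Data.Fin.Properties using (toℕ<n; toℕ-fromℕ<; toℕ-injective; combine-remQuot)
open import Data.Vec using ([]; _∷_)
open import Data.Product using (Σ; ∃; ∃₂; _×_; _,_; proj₁; proj₂)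
open import Data.Sum using (_⊎_; inj₁; inj₂; [_,_]′)
import Data.Sum as Sum
open import Data.Empty using (⊥; ⊥-elim)
open import Function using (_∘_; id)
open import Relation.Nullary using (yes; no; ¬_)
open import Relation.Binary.Bundles using (Setoid)
open import Relation.Binary.Structures using (IsEquivalence)
open import Relation.Binary.PropositionalEquality
import Relation.Binary.Reasoning.Setoid as SetoidReasoning

-- Congruences on ℕ

infix 4 _≡_mod_
_≡_mod_ : ℕ → ℕ → ℕ → Set
a ≡ b mod M = ∃₂ λ i j → a + i * M ≡ b + j * M

module _ {M : ℕ} where

  ≡⇒≡-mod : ∀ {a b} → a ≡ b → a ≡ b mod M
  ≡⇒≡-mod refl = 0 , 0 , refl

  mod-sym : ∀ {a b} → a ≡ b mod M → b ≡ a mod M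
  mod-sym (i , j , e) = j , i , sym e

  mod-trans : ∀ {a b c} → a ≡ b mod M → b ≡ c mod M → a ≡ c mod M
  mod-trans {a} {b} {c} (i , j , e) (i′ , j′ , e′) = i + i′ , j′ + j , (begin
    a + (i + i′) * M       ≡⟨ shuffle a i i′ M ⟩
    (a + i * M) + i′ * M   ≡⟨ cong (_+ i′ * M) e ⟩
    (b + j * M) + i′ * M   ≡⟨ swap b j i′ M ⟩
    (b + i′ * M) + j * M   ≡⟨ cong (_+ j * M) e′ ⟩
    (c + j′ * M) + j * M   ≡⟨ sym (shuffle c j′ j M) ⟩
    c + (j′ + j) * M       ∎)
    where
    open ≡-Reasoning
    shuffle : ∀ a i i′ M → a + (i + i′) * M ≡ (a + i * M) + i′ * M
    shuffle = solve-∀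
    swap : ∀ b j i′ M → (b + j * M) + i′ * M ≡ (b + i′ * M) + j * M
    swap = solve-∀

  mod-isEquivalence : IsEquivalence (λ a b → a ≡ b mod M)
  mod-isEquivalence = record { refl = ≡⇒≡-mod refl ; sym = mod-sym ; trans = mod-trans }

  +-cong-mod : ∀ {a b c d} → a ≡ b mod M → c ≡ d mod M → a + c ≡ b + d mod M
  +-cong-mod {a} {b} {c} {d} (i , j , e) (i′ , j′ , e′) = i + i′ , j + j′ , (begin
    a + c + (i + i′) * M         ≡⟨ shuffle a c i i′ M ⟩
    (a + i * M) + (c + i′ * M)   ≡⟨ cong₂ _+_ e e′ ⟩
    (b + j * M) + (d + j′ * M)   ≡⟨ sym (shuffle b d j j′ M) ⟩
    b + d + (j + j′) * M         ∎)
    where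
    open ≡-Reasoning
    shuffle : ∀ a c i i′ M → a + c + (i + i′) * M ≡ (a + i * M) + (c + i′ * M)
    shuffle = solve-∀

  +-congˡ-mod : ∀ c {a b} → a ≡ b mod M → c + a ≡ c + b mod M
  +-congˡ-mod c = +-cong-mod (≡⇒≡-mod refl)

  +-congʳ-mod : ∀ c {a b} → a ≡ b mod M → a + c ≡ b + c mod M
  +-congʳ-mod c a≡b = +-cong-mod a≡b (≡⇒≡-mod refl)

  +-cancelˡ-mod : ∀ c {a b} → c + a ≡ c + b mod M → a ≡ b mod M
  +-cancelˡ-mod c {a} {b} (i , j , e) = i , j , +-cancelˡ-≡ c _ _ (begin
    c + (a + i * M)   ≡⟨ +-assoc c a _ ⟨
    c + a + i * M     ≡⟨ e ⟩
    c + b + j * M     ≡⟨ +-assoc c b _ ⟩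
    c + (b + j * M)   ∎)
    where open ≡-Reasoning

  +-multiple-mod : ∀ a i → a + i * M ≡ a mod M
  +-multiple-mod a i = 0 , i , +-identityʳ _

mod-setoid : ℕ → Setoid _ _
mod-setoid M = record { isEquivalence = mod-isEquivalence {M} }

module _ {M : ℕ} .{{_ : NonZero M}} where

  %-mod : ∀ a → a % M ≡ a mod M
  %-mod a = a / M , 0 , trans (sym (m≡m%n+[m/n]*n a M)) (sym (+-identityʳ a))

  mod-injective-< : ∀ {a b} → a < M → b < M → a ≡ b mod M → a ≡ b
  mod-injective-< {a} {b} a<M b<M (i , j , e) = begin
    a                ≡⟨ m<n⇒m%n≡m a<M ⟨
    a % M            ≡⟨ [m+kn]%n≡m%n a i M ⟨
    (a + i * M) % M  ≡⟨ cong (_% M) e ⟩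
    (b + j * M) % M  ≡⟨ [m+kn]%n≡m%n b j M ⟩
    b % M            ≡⟨ m<n⇒m%n≡m b<M ⟩
    b                ∎
    where open ≡-Reasoning

  mod-apart : ∀ {a b} → a ≡ b mod M → a < b → b < a + M → ⊥
  mod-apart {a} {b} a≡b a<b b<a+M = m<n⇒n≢0 (m<n⇒0<n∸m a<b) (sym 0≡b∸a)
    where
    b∸a<M : b ∸ a < M
    b∸a<M = +-cancelˡ-< a _ _ (subst (_< a + M) (sym (m+[n∸m]≡n (<⇒≤ a<b))) b<a+M)
    0≡b∸a : 0 ≡ b ∸ a
    0≡b∸a = mod-injective-< (≤-<-trans z≤n b∸a<M) b∸a<M
              (+-cancelˡ-mod a (mod-trans (≡⇒≡-mod (+-identityʳ a)) (mod-trans a≡b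
                (≡⇒≡-mod (sym (m+[n∸m]≡n (<⇒≤ a<b)))))))

  difference-mod : ∀ o v → ∃ λ t → t < M × o + t ≡ v mod M
  difference-mod o v = t % M , m%n<n t M ,
    mod-trans (+-congˡ-mod o (%-mod t)) (mod-trans (≡⇒≡-mod o+t≡v+oM) (+-multiple-mod v o))
    where
    t = v + o * pred M
    o+t≡v+oM : o + t ≡ v + o * M
    o+t≡v+oM = begin
      o + (v + o * pred M)       ≡⟨ rearrange o v (pred M) ⟩
      v + o * suc (pred M)       ≡⟨ cong (λ x → v + o * x) (suc-pred M) ⟩
      v + o * M                  ∎
      where
      open ≡-Reasoning
      rearrange : ∀ o v p → o + (v + o * p) ≡ v + o * suc p
      rearrange = solve-∀

  mod-unique : ∀ {a} (i : Fin M) → a ≡ toℕ i mod M → a ℕ.mod M ≡ i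
  mod-unique {a} i a≡i = toℕ-injective (begin
    toℕ (a ℕ.mod M)  ≡⟨ toℕ-fromℕ< (m%n<n a M) ⟩
    a % M          ≡⟨ mod-injective-< (m%n<n a M) (toℕ<n i) (mod-trans (%-mod a) a≡i) ⟩
    toℕ i          ∎)
    where open ≡-Reasoning

-- Subfaces of a face

ones : ∀ {n} → Face n → ℕ
ones []      = 0
ones (𝟘 ∷ f) = ones f
ones (𝟙 ∷ f) = suc (ones f)
ones (⋆ ∷ f) = ones f

-- Stars are numbered from 0; both functions treat a missing i-th star as one placed after the last coordinate.
onesBefore : ∀ {n} → Face n → ℕ → ℕ
onesBefore []      i       = 0
onesBefore (𝟘 ∷ f) i       = onesBefore f i
onesBefore (𝟙 ∷ f) i       = suc (onesBefore f i)
onesBefore (⋆ ∷ f) zero    = 0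
onesBefore (⋆ ∷ f) (suc i) = onesBefore f i

starIndex : ∀ {n} → Face n → ℕ → ℕ
starIndex []      i       = 0
starIndex (𝟘 ∷ f) i       = suc (starIndex f i)
starIndex (𝟙 ∷ f) i       = suc (starIndex f i)
starIndex (⋆ ∷ f) zero    = 0
starIndex (⋆ ∷ f) (suc i) = suc (starIndex f i)

-- A face F is a cube of dimension dim F; embed F sends each face of that cube to the corresponding subface of F.
embed : ∀ {n} (F : Face n) → Face (dim F) → Face n
embed []      []      = []
embed (𝟘 ∷ F) P       = 𝟘 ∷ embed F P
embed (𝟙 ∷ F) P       = 𝟙 ∷ embed F P
embed (⋆ ∷ F) (s ∷ P) = s ∷ embed F P

embed-⊑ : ∀ {n} (F : Face n) P → embed F P ⊑ F
embed-⊑ []      []      = []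
embed-⊑ (𝟘 ∷ F) P       = ⊑-𝟘 ∷ embed-⊑ F P
embed-⊑ (𝟙 ∷ F) P       = ⊑-𝟙 ∷ embed-⊑ F P
embed-⊑ (⋆ ∷ F) (s ∷ P) = ⊑-⋆ ∷ embed-⊑ F P

embed-dim : ∀ {n} (F : Face n) P → dim (embed F P) ≡ dim P
embed-dim []      []      = refl
embed-dim (𝟘 ∷ F) P       = embed-dim F P
embed-dim (𝟙 ∷ F) P       = embed-dim F P
embed-dim (⋆ ∷ F) (𝟘 ∷ P) = embed-dim F P
embed-dim (⋆ ∷ F) (𝟙 ∷ P) = embed-dim F P
embed-dim (⋆ ∷ F) (⋆ ∷ P) = cong suc (embed-dim F P)

embed-ones : ∀ {n} (F : Face n) P → ones (embed F P) ≡ ones F + ones P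
embed-ones []      []      = refl
embed-ones (𝟘 ∷ F) P       = embed-ones F P
embed-ones (𝟙 ∷ F) P       = cong suc (embed-ones F P)
embed-ones (⋆ ∷ F) (𝟘 ∷ P) = embed-ones F P
embed-ones (⋆ ∷ F) (𝟙 ∷ P) = trans (cong suc (embed-ones F P)) (sym (+-suc _ _))
embed-ones (⋆ ∷ F) (⋆ ∷ P) = embed-ones F P

embed-onesBefore : ∀ {n} (F : Face n) P i →
                   onesBefore (embed F P) i ≡ onesBefore F (starIndex P i) + onesBefore P i
embed-onesBefore []      []      i       = refl
embed-onesBefore (𝟘 ∷ F) P       i       = embed-onesBefore F P i
embed-onesBefore (𝟙 ∷ F) P       i       = cong suc (embed-onesBefore F P i)
embed-onesBefore (⋆ ∷ F) (𝟘 ∷ P) i       = embed-onesBefore F P i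
embed-onesBefore (⋆ ∷ F) (𝟙 ∷ P) i       = trans (cong suc (embed-onesBefore F P i)) (sym (+-suc _ _))
embed-onesBefore (⋆ ∷ F) (⋆ ∷ P) zero    = refl
embed-onesBefore (⋆ ∷ F) (⋆ ∷ P) (suc i) = embed-onesBefore F P i

subst-invariant : ∀ {A : Set} (f : ∀ {n} → Face n → A) {n n′} (e : n ≡ n′) (P : Face n) →
                  f (subst Face e P) ≡ f P
subst-invariant f refl P = refl

-- block L X R puts L fixed coordinates in front of R: X ones followed by zeros (when X ≤ L).
block : ∀ {r} (L X : ℕ) → Face r → Face (L + r)
block zero    X       R = R
block (suc L) zero    R = 𝟘 ∷ block L zero R
block (suc L) (suc X) R = 𝟙 ∷ block L X R

module _ {r} (R : Face r) where

  block-dim : ∀ L X → dim (block L X R) ≡ dim R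
  block-dim zero    X       = refl
  block-dim (suc L) zero    = block-dim L zero
  block-dim (suc L) (suc X) = block-dim L X

  block-ones : ∀ {L X} → X ≤ L → ones (block L X R) ≡ X + ones R
  block-ones {zero}  z≤n       = refl
  block-ones {suc L} z≤n       = block-ones {L} z≤n
  block-ones {suc L} (s≤s X≤L) = cong suc (block-ones X≤L)

  block-starIndex : ∀ L X i → starIndex (block L X R) i ≡ L + starIndex R i
  block-starIndex zero    X       i = refl
  block-starIndex (suc L) zero    i = cong suc (block-starIndex L zero i)
  block-starIndex (suc L) (suc X) i = cong suc (block-starIndex L X i)

  block-onesBefore : ∀ {L X} i → X ≤ L → onesBefore (block L X R) i ≡ X + onesBefore R i
  block-onesBefore {zero}  i z≤n       = refl
  block-onesBefore {suc L} i z≤n       = block-onesBefore {L} i z≤n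
  block-onesBefore {suc L} i (s≤s X≤L) = cong suc (block-onesBefore i X≤L)

module _ (L₀ L₁ L₂ X Y Z : ℕ) where

  twoStars : Face (L₀ + suc (L₁ + suc (L₂ + 0)))
  twoStars = block L₀ X (⋆ ∷ block L₁ Y (⋆ ∷ block L₂ Z []))

  twoStars-dim : dim twoStars ≡ 2
  twoStars-dim = trans (block-dim _ L₀ X) (cong suc (trans (block-dim _ L₁ Y) (cong suc (block-dim [] L₂ Z))))

  twoStars-starIndex₀ : starIndex twoStars 0 ≡ L₀
  twoStars-starIndex₀ = trans (block-starIndex _ L₀ X 0) (+-identityʳ L₀)

  twoStars-starIndex₁ : starIndex twoStars 1 ≡ L₀ + suc L₁
  twoStars-starIndex₁ = trans (block-starIndex _ L₀ X 1)
                          (cong (λ i → L₀ + suc i) (trans (block-starIndex _ L₁ Y 0) (+-identityʳ L₁)))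

  module _ (X≤L₀ : X ≤ L₀) (Y≤L₁ : Y ≤ L₁) (Z≤L₂ : Z ≤ L₂) where

    twoStars-ones : ones twoStars ≡ X + Y + Z
    twoStars-ones = begin
      ones twoStars                      ≡⟨ block-ones _ X≤L₀ ⟩
      X + ones (block L₁ Y (⋆ ∷ _))      ≡⟨ cong (X +_) (block-ones _ Y≤L₁) ⟩
      X + (Y + ones (block L₂ Z []))     ≡⟨ cong (λ z → X + (Y + z)) (trans (block-ones _ Z≤L₂) (+-identityʳ Z)) ⟩
      X + (Y + Z)                        ≡⟨ +-assoc X Y Z ⟨
      X + Y + Z                          ∎
      where open ≡-Reasoning

    twoStars-onesBefore₀ : onesBefore twoStars 0 ≡ X
    twoStars-onesBefore₀ = trans (block-onesBefore _ 0 X≤L₀) (+-identityʳ X)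

    twoStars-onesBefore₁ : onesBefore twoStars 1 ≡ X + Y
    twoStars-onesBefore₁ = trans (block-onesBefore _ 1 X≤L₀)
                             (cong (X +_) (trans (block-onesBefore _ 0 Y≤L₁) (+-identityʳ Y)))

radix-decomposition : ∀ {k} a b n → k ≤ suc a → n ≤ a + k * b →
                      ∃₂ λ X Y → X ≤ a × Y ≤ b × X + k * b ≡ n + k * Y
radix-decomposition {k} a zero n _ n≤a+k*0 =
  n , 0 , subst (n ≤_) (trans (cong (a +_) (*-zeroʳ k)) (+-identityʳ a)) n≤a+k*0 , z≤n , refl
radix-decomposition {k} a (suc b) n k≤1+a n≤ with n ≤? a
... | yes n≤a = n , suc b , n≤a , ≤-refl , refl
... | no n≰a =
  let X , Y , X≤a , Y≤b , eq = radix-decomposition a b (n ∸ k) k≤1+a n∸k≤ in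
  X , Y , X≤a , m≤n⇒m≤1+n Y≤b , (begin
    X + k * suc b        ≡⟨ rearrange X k b ⟩
    k + (X + k * b)      ≡⟨ cong (k +_) eq ⟩
    k + (n ∸ k + k * Y)  ≡⟨ +-assoc k (n ∸ k) _ ⟨
    k + (n ∸ k) + k * Y  ≡⟨ cong (_+ k * Y) (m+[n∸m]≡n k≤n) ⟩
    n + k * Y            ∎)
  where
  open ≡-Reasoning
  rearrange : ∀ X k b → X + k * suc b ≡ k + (X + k * b)
  rearrange = solve-∀
  k≤n : k ≤ n
  k≤n = ≤-trans k≤1+a (≰⇒> n≰a)
  n∸k≤ : n ∸ k ≤ a + k * b
  n∸k≤ = subst (n ∸ k ≤_) (m+n∸n≡m (a + k * b) k)
           (∸-monoˡ-≤ k (subst (n ≤_) (trans (cong (a +_) (*-suc k b)) (shift a k (k * b))) n≤))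
    where
    shift : ∀ a k c → a + (k + c) ≡ a + c + k
    shift = solve-∀

-- The colouring

module Construction (k₀ y q₀ : ℕ) (k₀≤q₀ : k₀ ≤ q₀) (y≤q₀ : y ≤ q₀) where

  k q Q m : ℕ
  k = suc k₀
  q = 2 + q₀
  Q = suc (k * (2 + y))
  m = suc (k * suc y)

  k<q : k < q
  k<q = s≤s (s≤s k₀≤q₀)

  1+y<q : suc y < q
  1+y<q = s≤s (s≤s y≤q₀)

  carry : ∀ X Y → X + m * Y ≡ X + k + m * suc Y mod Q
  carry X Y = 1 , 0 , lemma k₀ y X Y
    where
    lemma : ∀ k₀ y X Y → X + suc (suc k₀ * suc y) * Y + 1 * suc (suc k₀ * (2 + y))
                       ≡ X + suc k₀ + suc (suc k₀ * suc y) * suc Y + 0 * suc (suc k₀ * (2 + y))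
    lemma = solve-∀

  wrap : ∀ X → X + m * (2 + y) ≡ suc X + m * 0 mod Q
  wrap X = 0 , suc y , lemma k₀ y X
    where
    lemma : ∀ k₀ y X → X + suc (suc k₀ * suc y) * (2 + y) + 0 * suc (suc k₀ * (2 + y))
                     ≡ suc X + suc (suc k₀ * suc y) * 0 + suc y * suc (suc k₀ * (2 + y))
    lemma = solve-∀

  collect : ∀ n Y → n + k * Y + m * Y ≡ n + Y * Q
  collect n Y = lemma k₀ y n Y
    where
    lemma : ∀ k₀ y n Y → n + suc k₀ * Y + suc (suc k₀ * suc y) * Y ≡ n + Y * suc (suc k₀ * (2 + y))
    lemma = solve-∀

  offset : ℕ → ℕ → ℕ
  offset b₀ b₁ = suc k * b₀ + m * b₁

  offset-cross : ∀ c₁ c₂ c₃ c₄ → offset c₁ c₃ + offset c₂ c₄ ≡ offset c₁ c₄ + offset c₂ c₃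
  offset-cross c₁ c₂ c₃ c₄ = lemma (suc k) m c₁ c₂ c₃ c₄
    where
    lemma : ∀ a m c₁ c₂ c₃ c₄ →
            a * c₁ + m * c₃ + (a * c₂ + m * c₄) ≡ a * c₁ + m * c₄ + (a * c₂ + m * c₃)
    lemma = solve-∀

  offset-shift : ∀ b₀ b₁ X Y → offset (b₀ + X) (b₁ + (X + Y)) ≡ offset b₀ b₁ + (X + m * Y) mod Q
  offset-shift b₀ b₁ X Y = 0 , X , lemma k₀ y b₀ b₁ X Y
    where
    lemma : ∀ k₀ y b₀ b₁ X Y →
            suc (suc k₀) * (b₀ + X) + suc (suc k₀ * suc y) * (b₁ + (X + Y)) + 0 * suc (suc k₀ * (2 + y))
            ≡ suc (suc k₀) * b₀ + suc (suc k₀ * suc y) * b₁ + (X + suc (suc k₀ * suc y) * Y)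
              + X * suc (suc k₀ * (2 + y))
    lemma = solve-∀

  -- W is the number of ones of the ambient face and (v , u) the colour to be realised.
  module Target (W v u : ℕ) where

    record Hit (L₀ L₁ o : ℕ) : Set where
      constructor hit
      field
        X Y  : ℕ
        X≤L₀ : X ≤ L₀
        Y≤L₁ : Y ≤ L₁
        hits : o + (X + m * Y) ≡ v mod Q

    Fill : ℕ → ℕ → Set
    Fill L₂ s = ∃ λ Z → Z ≤ L₂ × W + s + Z ≡ u mod q

    Choice : ℕ → ℕ → ℕ → ℕ → Set
    Choice L₀ L₁ L₂ o = Σ (Hit L₀ L₁ o) λ h → Fill L₂ (Hit.X h + Hit.Y h)

    -- Modulo Q, X + m Y ≡ X − k Y runs through −k b, …, a; a gap is a residue a + t beyond them.
    Gap : ℕ → ℕ → ℕ → Set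
    Gap a b o = ∃ λ t → 0 < t × a + k * b + t < Q × o + (a + t) ≡ v mod Q

    hit-or-gap : ∀ a b o → k ≤ suc a → Hit a b o ⊎ Gap a b o
    hit-or-gap a b o k≤1+a = from-difference (difference-mod o v)
      where
      reaches : ∀ r x → o + r ≡ v mod Q → x + k * b ≡ r + k * b mod Q → o + x ≡ v mod Q
      reaches r x o+r≡v x+kb≡r+kb = mod-trans (+-congˡ-mod o (+-cancelˡ-mod (k * b)
        (mod-trans (≡⇒≡-mod (+-comm (k * b) x)) (mod-trans x+kb≡r+kb (≡⇒≡-mod (+-comm r (k * b))))))) o+r≡v
      classify : ∀ r n → n ≡ r + k * b mod Q → n < Q → o + r ≡ v mod Q → Hit a b o ⊎ Gap a b o
      classify r n n≡ n<Q o+r≡v with n ≤? a + k * b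
      ... | yes n≤ =
        let X , Y , X≤a , Y≤b , eq = radix-decomposition a b n k≤1+a n≤ in
        inj₁ (hit X Y X≤a Y≤b (reaches r (X + m * Y) o+r≡v (begin
          X + m * Y + k * b    ≡⟨ swap X (m * Y) (k * b) ⟩
          X + k * b + m * Y    ≡⟨ cong (_+ m * Y) eq ⟩
          n + k * Y + m * Y    ≡⟨ collect n Y ⟩
          n + Y * Q            ≈⟨ +-multiple-mod n Y ⟩
          n                    ≈⟨ n≡ ⟩
          r + k * b            ∎)))
        where
        open SetoidReasoning (mod-setoid Q)
        swap : ∀ X c d → X + c + d ≡ X + d + c
        swap = solve-∀
      ... | no n≰ =
        inj₂ (t , m<n⇒0<n∸m (≰⇒> n≰) , subst (_< Q) (sym a+kb+t≡n) n<Q ,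
              reaches r (a + t) o+r≡v (mod-trans (≡⇒≡-mod (trans (swap a t (k * b)) a+kb+t≡n)) n≡))
        where
        t = n ∸ (a + k * b)
        a+kb+t≡n : a + k * b + t ≡ n
        a+kb+t≡n = m+[n∸m]≡n (<⇒≤ (≰⇒> n≰))
        swap : ∀ a t c → a + t + c ≡ a + c + t
        swap = solve-∀
      from-difference : (∃ λ r → r < Q × o + r ≡ v mod Q) → Hit a b o ⊎ Gap a b o
      from-difference (r , _ , o+r≡v) = classify r ((r + k * b) % Q) (%-mod (r + k * b)) (m%n<n (r + k * b) Q) o+r≡v

    extend : ∀ {L₀ L₁ o} → Hit L₀ L₁ o → Choice L₀ L₁ (suc q₀) o
    extend h = let Z , Z<q , e = difference-mod (W + (Hit.X h + Hit.Y h)) u in h , Z , ≤-pred Z<q , e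

    -- The layouts: the stars of G are star k₀ (A) or k (B) of F, and star k + 1 + y (C) or k + 2 + y (D).
    hit-AC : ∀ o → Hit k₀ (suc y) o ⊎ o + k ≡ v mod Q
    hit-AC o = Sum.map₂ gap-is-k (hit-or-gap k₀ (suc y) o ≤-refl)
      where
      gap-is-k : Gap k₀ (suc y) o → o + k ≡ v mod Q
      gap-is-k (t , 0<t , <Q , e) = subst (λ x → o + x ≡ v mod Q) k₀+t≡k e
        where
        Q≡ : ∀ k₀ y → suc (suc k₀ * (2 + y)) ≡ suc (k₀ + suc k₀ * suc y + 1)
        Q≡ = solve-∀
        t≤1 : t ≤ 1
        t≤1 = +-cancelˡ-≤ (k₀ + k * suc y) t 1 (≤-pred (subst (k₀ + k * suc y + t <_) (Q≡ k₀ y) <Q))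
        k₀+t≡k : k₀ + t ≡ k
        k₀+t≡k = trans (cong (k₀ +_) (≤-antisym t≤1 0<t)) (+-comm k₀ 1)

    hit-BC : ∀ o → Hit k y o ⊎ ∃ λ t → 0 < t × t ≤ k × o + (k + t) ≡ v mod Q
    hit-BC o = Sum.map₂ gap-≤-k (hit-or-gap k y o (n≤1+n k))
      where
      gap-≤-k : Gap k y o → ∃ λ t → 0 < t × t ≤ k × o + (k + t) ≡ v mod Q
      gap-≤-k (t , 0<t , <Q , e) = t , 0<t , t≤k , e
        where
        Q≡ : ∀ k₀ y → suc (suc k₀ * (2 + y)) ≡ suc (suc k₀ + suc k₀ * y + suc k₀)
        Q≡ = solve-∀
        t≤k : t ≤ k
        t≤k = +-cancelˡ-≤ (k + k * y) t k (≤-pred (subst (k + k * y + t <_) (Q≡ k₀ y) <Q))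

    hit-full : ∀ {a b} o → k ≤ suc a → Q ≤ suc (a + k * b) → Hit a b o
    hit-full {a} {b} o k≤1+a Q≤ = [ id , ⊥-elim ∘ no-gap ]′ (hit-or-gap a b o k≤1+a)
      where
      no-gap : Gap a b o → ⊥
      no-gap (t , 0<t , <Q , _) = <⇒≱ 0<t t≤0
        where
        t≤0 : t ≤ 0
        t≤0 = +-cancelˡ-≤ (a + k * b) t 0
                (subst (a + k * b + t ≤_) (sym (+-identityʳ _)) (≤-pred (≤-trans <Q Q≤)))

    Blocked : ℕ → Set
    Blocked s = W + s + suc q₀ ≡ u mod q

    fill-or-blocked : ∀ s → Fill q₀ s ⊎ Blocked s
    fill-or-blocked s = from-difference (difference-mod (W + s) u)
      where
      from-difference : (∃ λ Z → Z < q × W + s + Z ≡ u mod q) → Fill q₀ s ⊎ Blocked s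
      from-difference (Z , Z<q , e) with m≤n⇒m<n∨m≡n (≤-pred Z<q)
      ... | inj₁ Z<1+q₀ = inj₁ (Z , ≤-pred Z<1+q₀ , e)
      ... | inj₂ refl   = inj₂ e

    fill-unblocked : ∀ s → ¬ Blocked s → Fill q₀ s
    fill-unblocked s ¬blocked = [ id , ⊥-elim ∘ ¬blocked ]′ (fill-or-blocked s)

    blocked-apart : ∀ {s s′ a b} → Blocked s → Blocked s′ → s + a ≡ s′ + b → a < b → b < a + q → ⊥
    blocked-apart {s} {s′} {a} {b} blocked blocked′ e = mod-apart (+-cancelˡ-mod u (begin
      u + a                  ≈⟨ +-congʳ-mod a blocked ⟨
      W + s + suc q₀ + a     ≡⟨ swap W s (suc q₀) a ⟩
      W + suc q₀ + (s + a)   ≡⟨ cong (W + suc q₀ +_) e ⟩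
      W + suc q₀ + (s′ + b)  ≡⟨ swap W s′ (suc q₀) b ⟨
      W + s′ + suc q₀ + b    ≈⟨ +-congʳ-mod b blocked′ ⟩
      u + b                  ∎))
      where
      open SetoidReasoning (mod-setoid q)
      swap : ∀ W s c a → W + s + c + a ≡ W + c + (s + a)
      swap = solve-∀

    module _ {oA oB t : ℕ} (0<t : 0 < t) (t≤k : t ≤ k) (shift : oB + t ≡ oA mod Q) where

      shifted : ∀ X Y → oA + (X + m * Y) ≡ v mod Q → oB + (X + t + m * Y) ≡ v mod Q
      shifted X Y hits = mod-trans (≡⇒≡-mod (swap oB X t (m * Y))) (mod-trans (+-congʳ-mod (X + m * Y) shift) hits)
        where
        swap : ∀ o X t c → o + (X + t + c) ≡ o + t + (X + c)
        swap = solve-∀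

      t<q : t < q
      t<q = ≤-<-trans t≤k k<q

      -- A blocked hit in layout AD is replaced by a hit whose X + Y differs by t, y + 1, k or k + 1 − t.
      fits : ∀ X Y → X ≤ k₀ → Y ≤ 2 + y → oA + (X + m * Y) ≡ v mod Q → Blocked (X + Y) → X + t ≤ k →
             Choice k₀ (2 + y) q₀ oA ⊎ Choice k (suc y) q₀ oB
      fits X Y X≤k₀ Y≤2+y hits blocked X+t≤k with m≤n⇒m<n∨m≡n Y≤2+y
      ... | inj₁ Y<2+y = inj₂ (hit (X + t) Y X+t≤k (≤-pred Y<2+y) (shifted X Y hits) ,
                               fill-unblocked _ λ blocked′ → blocked-apart blocked′ blocked (swap X t Y) 0<t t<q)
        where
        swap : ∀ X t Y → X + t + Y + 0 ≡ X + Y + t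
        swap = solve-∀
      ... | inj₂ refl with m≤n⇒m<n∨m≡n X≤k₀
      ...   | inj₁ X<k₀ = inj₁ (hit (suc X) 0 X<k₀ z≤n (mod-trans (+-congˡ-mod oA (mod-sym (wrap X))) hits) ,
                                fill-unblocked _ λ blocked′ → blocked-apart blocked blocked′ (swap X y) z<s 1+y<q)
        where
        swap : ∀ X y → X + (2 + y) + 0 ≡ suc X + 0 + suc y
        swap = solve-∀
      ...   | inj₂ refl = inj₂ (hit 0 (suc y) z≤n ≤-refl hits′ ,
                                fill-unblocked _ λ blocked′ → blocked-apart blocked blocked′ (swap k₀ y) z<s k<q)
        where
        open SetoidReasoning (mod-setoid Q)
        swap : ∀ k₀ y → k₀ + (2 + y) + 0 ≡ 0 + suc y + suc k₀
        swap = solve-∀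
        k≡k₀+t : k ≡ k₀ + t
        k≡k₀+t = trans (+-comm 1 k₀)
                   (cong (k₀ +_) (≤-antisym 0<t (+-cancelˡ-≤ k₀ t 1 (subst (k₀ + t ≤_) (+-comm 1 k₀) X+t≤k))))
        hits′ : oB + (0 + m * suc y) ≡ v mod Q
        hits′ = begin
          oB + (0 + m * suc y)           ≈⟨ +-congˡ-mod oB (carry 0 (suc y)) ⟩
          oB + (k + m * (2 + y))         ≡⟨ cong (λ x → oB + (x + m * (2 + y))) k≡k₀+t ⟩
          oB + (k₀ + t + m * (2 + y))    ≈⟨ shifted k₀ (2 + y) hits ⟩
          v                              ∎

      overflows : ∀ X Y → X ≤ k₀ → Y ≤ 2 + y → oA + (X + m * Y) ≡ v mod Q → Blocked (X + Y) → k < X + t →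
                  Choice k₀ (2 + y) q₀ oA ⊎ Choice k (suc y) q₀ oB
      overflows zero zero _ _ _ _ k<t = ⊥-elim (<⇒≱ k<t t≤k)
      overflows (suc X) zero X<k₀ _ hits blocked _ =
        inj₁ (hit X (2 + y) (<⇒≤ X<k₀) ≤-refl (mod-trans (+-congˡ-mod oA (wrap X)) hits) ,
              fill-unblocked _ λ blocked′ → blocked-apart blocked′ blocked (swap X y) z<s 1+y<q)
        where
        swap : ∀ X y → X + (2 + y) + 0 ≡ suc X + 0 + suc y
        swap = solve-∀
      overflows X (suc Y) X≤k₀ Y<2+y hits blocked k<X+t =
        inj₂ (hit D Y D≤k (≤-pred Y<2+y) hits′ ,
              fill-unblocked _ λ blocked′ → blocked-apart blocked blocked′ sums (s≤s t≤k) (+-mono-≤ 0<t k<q))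
        where
        open SetoidReasoning (mod-setoid Q)
        D = X + t ∸ k
        D+k≡X+t : D + k ≡ X + t
        D+k≡X+t = m∸n+n≡m (<⇒≤ k<X+t)
        D≤k : D ≤ k
        D≤k = m≤n⇒m≤1+n (+-cancelʳ-≤ k D k₀ (subst (_≤ k₀ + k) (sym D+k≡X+t) (+-mono-≤ X≤k₀ t≤k)))
        hits′ : oB + (D + m * Y) ≡ v mod Q
        hits′ = begin
          oB + (D + m * Y)              ≈⟨ +-congˡ-mod oB (carry D Y) ⟩
          oB + (D + k + m * suc Y)      ≡⟨ cong (λ x → oB + (x + m * suc Y)) D+k≡X+t ⟩
          oB + (X + t + m * suc Y)      ≈⟨ shifted X (suc Y) hits ⟩
          v                             ∎
        sums : X + suc Y + t ≡ D + Y + suc k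
        sums = trans (swap₁ X Y t) (trans (cong (suc Y +_) (sym D+k≡X+t)) (swap₂ D Y k))
          where
          swap₁ : ∀ X Y t → X + suc Y + t ≡ suc Y + (X + t)
          swap₁ = solve-∀
          swap₂ : ∀ D Y k → suc Y + (D + k) ≡ D + Y + suc k
          swap₂ = solve-∀

      hit-D : Choice k₀ (2 + y) q₀ oA ⊎ Choice k (suc y) q₀ oB
      hit-D = try (hit-full oA ≤-refl (s≤s (m≤n+m _ k₀)))
        where
        try : Hit k₀ (2 + y) oA → Choice k₀ (2 + y) q₀ oA ⊎ Choice k (suc y) q₀ oB
        try h@(hit X Y X≤k₀ Y≤2+y hits) = [ inj₁ ∘ (h ,_) , reroute ]′ (fill-or-blocked (X + Y))
          where
          reroute : Blocked (X + Y) → Choice k₀ (2 + y) q₀ oA ⊎ Choice k (suc y) q₀ oB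
          reroute blocked with X + t ≤? k
          ... | yes X+t≤k = fits X Y X≤k₀ Y≤2+y hits blocked X+t≤k
          ... | no X+t≰k  = overflows X Y X≤k₀ Y≤2+y hits blocked (≰⇒> X+t≰k)

    missed-twice : ∀ c₁ c₂ c₃ c₄ {t} → offset c₁ c₃ + k ≡ v mod Q → offset c₂ c₃ + (k + t) ≡ v mod Q →
                   offset c₂ c₄ + t ≡ offset c₁ c₄ mod Q
    missed-twice c₁ c₂ c₃ c₄ {t} AC-missed BC-missed = +-cancelˡ-mod (offset c₁ c₃ + k) (begin
      offset c₁ c₃ + k + (offset c₂ c₄ + t)    ≡⟨ regroup ⟩
      offset c₁ c₄ + (offset c₂ c₃ + (k + t))
        ≈⟨ +-congˡ-mod (offset c₁ c₄) (mod-trans BC-missed (mod-sym AC-missed)) ⟩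
      offset c₁ c₄ + (offset c₁ c₃ + k)        ≡⟨ +-comm (offset c₁ c₄) _ ⟩
      offset c₁ c₃ + k + offset c₁ c₄          ∎)
      where
      open SetoidReasoning (mod-setoid Q)
      regroup : offset c₁ c₃ + k + (offset c₂ c₄ + t) ≡ offset c₁ c₄ + (offset c₂ c₃ + (k + t))
      regroup = trans (swap (offset c₁ c₃) (offset c₂ c₄) k t)
                  (trans (cong (_+ (k + t)) (offset-cross c₁ c₂ c₃ c₄))
                         (+-assoc (offset c₁ c₄) (offset c₂ c₃) (k + t)))
        where
        swap : ∀ a b k t → a + k + (b + t) ≡ a + b + (k + t)
        swap = solve-∀

    four-layouts : ∀ c₁ c₂ c₃ c₄ →
      Choice k₀ (suc y) (suc q₀) (offset c₁ c₃) ⊎ Choice k y (suc q₀) (offset c₂ c₃) ⊎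
      Choice k₀ (2 + y) q₀ (offset c₁ c₄) ⊎ Choice k (suc y) q₀ (offset c₂ c₄)
    four-layouts c₁ c₂ c₃ c₄ =
      Sum.map extend (λ AC-missed →
        Sum.map extend (λ (t , 0<t , t≤k , BC-missed) →
                         hit-D 0<t t≤k (missed-twice c₁ c₂ c₃ c₄ AC-missed BC-missed))
          (hit-BC (offset c₂ c₃)))
        (hit-AC (offset c₁ c₃))

  colour : ∀ {n} → Face n → Fin (Q * q)
  colour G = combine (offset (onesBefore G 0) (onesBefore G 1) ℕ.mod Q) (ones G ℕ.mod q)

  ColouredSubface : ∀ {n} → Face n → Fin (Q * q) → Set
  ColouredSubface {n} F c = Σ (Face[ 2 ] n) λ G → proj₁ G ⊑ F × colour (proj₁ G) ≡ c

  realise : ∀ {n} (F : Face n) (vF : Fin Q) (uF : Fin q) {L₀ L₁ L₂ i} →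
            L₀ + suc (L₁ + suc (L₂ + 0)) ≡ dim F → L₀ + suc L₁ ≡ i →
            Target.Choice (ones F) (toℕ vF) (toℕ uF) L₀ L₁ L₂ (offset (onesBefore F L₀) (onesBefore F i)) →
            ColouredSubface F (combine vF uF)
  realise F vF uF {L₀} {L₁} {L₂} e refl (Target.hit X Y X≤L₀ Y≤L₁ hits , Z , Z≤L₂ , fill) =
    (G , trans (embed-dim F P) (trans (subst-invariant dim e pat) (twoStars-dim L₀ L₁ L₂ X Y Z))) ,
    embed-⊑ F P ,
    cong₂ combine (mod-unique vF ψ≡v) (mod-unique uF ones≡u)
    where
    pat = twoStars L₀ L₁ L₂ X Y Z
    P = subst Face e pat
    G = embed F P
    onesBefore-G : ∀ i → onesBefore G i ≡ onesBefore F (starIndex pat i) + onesBefore pat i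
    onesBefore-G i = trans (embed-onesBefore F P i)
                       (cong₂ _+_ (cong (onesBefore F) (subst-invariant (λ R → starIndex R i) e pat))
                                  (subst-invariant (λ R → onesBefore R i) e pat))
    b₀ : onesBefore G 0 ≡ onesBefore F L₀ + X
    b₀ = trans (onesBefore-G 0) (cong₂ _+_ (cong (onesBefore F) (twoStars-starIndex₀ L₀ L₁ L₂ X Y Z))
                                           (twoStars-onesBefore₀ L₀ L₁ L₂ X Y Z X≤L₀ Y≤L₁ Z≤L₂))
    b₁ : onesBefore G 1 ≡ onesBefore F (L₀ + suc L₁) + (X + Y)
    b₁ = trans (onesBefore-G 1) (cong₂ _+_ (cong (onesBefore F) (twoStars-starIndex₁ L₀ L₁ L₂ X Y Z))
                                           (twoStars-onesBefore₁ L₀ L₁ L₂ X Y Z X≤L₀ Y≤L₁ Z≤L₂))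
    ψ≡v : offset (onesBefore G 0) (onesBefore G 1) ≡ toℕ vF mod Q
    ψ≡v = begin
      offset (onesBefore G 0) (onesBefore G 1)              ≡⟨ cong₂ offset b₀ b₁ ⟩
      offset (c L₀ + X) (c (L₀ + suc L₁) + (X + Y))         ≈⟨ offset-shift (c L₀) (c (L₀ + suc L₁)) X Y ⟩
      offset (c L₀) (c (L₀ + suc L₁)) + (X + m * Y)         ≈⟨ hits ⟩
      toℕ vF                                                ∎
      where
      open SetoidReasoning (mod-setoid Q)
      c = onesBefore F
    ones≡u : ones G ≡ toℕ uF mod q
    ones≡u = mod-trans (≡⇒≡-mod (begin
      ones G                  ≡⟨ embed-ones F P ⟩
      ones F + ones P         ≡⟨ cong (ones F +_) (subst-invariant ones e pat) ⟩
      ones F + ones pat       ≡⟨ cong (ones F +_) (twoStars-ones L₀ L₁ L₂ X Y Z X≤L₀ Y≤L₁ Z≤L₂) ⟩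
      ones F + (X + Y + Z)    ≡⟨ +-assoc (ones F) (X + Y) Z ⟨
      ones F + (X + Y) + Z    ∎)) fill
      where open ≡-Reasoning

  d : ℕ
  d = k + y + q + 1

  every-colour : ∀ {n} (F : Face n) → dim F ≡ d → ∀ vF uF → ColouredSubface F (combine vF uF)
  every-colour F dimF vF uF =
    [ realise F vF uF (trans (AC k₀ y q₀) (sym dimF)) (+-suc k₀ (suc y)) ,
    [ realise F vF uF (trans (BC k₀ y q₀) (sym dimF)) refl ,
    [ realise F vF uF (trans (AD k₀ y q₀) (sym dimF)) (+-suc k₀ (2 + y)) ,
      realise F vF uF (trans (BD k₀ y q₀) (sym dimF)) refl ]′ ]′ ]′
    (Target.four-layouts (ones F) (toℕ vF) (toℕ uF)
      (onesBefore F k₀) (onesBefore F k) (onesBefore F (k + suc y)) (onesBefore F (k + (2 + y))))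
    where
    AC : ∀ k₀ y q₀ → k₀ + suc (suc y + suc (suc q₀ + 0)) ≡ suc k₀ + y + (2 + q₀) + 1
    AC = solve-∀
    BC : ∀ k₀ y q₀ → suc k₀ + suc (y + suc (suc q₀ + 0)) ≡ suc k₀ + y + (2 + q₀) + 1
    BC = solve-∀
    AD : ∀ k₀ y q₀ → k₀ + suc (2 + y + suc (q₀ + 0)) ≡ suc k₀ + y + (2 + q₀) + 1
    AD = solve-∀
    BD : ∀ k₀ y q₀ → suc k₀ + suc (suc y + suc (q₀ + 0)) ≡ suc k₀ + y + (2 + q₀) + 1
    BD = solve-∀

  admissible : Admissible 2 d (Q * q)
  admissible n _ = colour ∘ proj₁ , λ F dimF c →
    subst (ColouredSubface F) (combine-remQuot {Q} q c)
          (every-colour F dimF (proj₁ (remQuot {Q} q c)) (proj₂ (remQuot {Q} q c)))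

p²-lower-bound : ∀ k y q → 0 < k → k < q → 2 + y ≤ q → Admissible 2 (k + y + q + 1) (suc (k * (2 + y)) * q)
p²-lower-bound (suc k₀) y (suc (suc q₀)) _ (s≤s (s≤s k₀≤q₀)) (s≤s (s≤s y≤q₀)) =
  Construction.admissible k₀ y q₀ k₀≤q₀ y≤q₀

-- The three residues of d modulo 3

quotient-by-3 : ∀ n c K → c < 3 → n ≡ c + K * 3 → n / 3 ≡ K
quotient-by-3 n c K c<3 refl = begin
  (c + K * 3) / 3      ≡⟨ +-distrib-/ c (K * 3) c%3+K*3%3<3 ⟩
  c / 3 + K * 3 / 3    ≡⟨ cong₂ _+_ (m<n⇒m/n≡0 c<3) (m*n/n≡m K 3) ⟩
  K                    ∎
  where
  open ≡-Reasoning
  c%3+K*3%3<3 : c % 3 + K * 3 % 3 < 3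
  c%3+K*3%3<3 = subst (_< 3) (sym (trans (cong₂ _+_ (m<n⇒m%n≡m c<3) (m*n%n≡0 K 3)) (+-identityʳ c))) c<3

pbas-2 : ∀ d {a b c} → (d + 1 + 2) / 3 ≡ a → (d + 1) / 3 ≡ b → d % 3 ≡ c →
         pbas 2 d ≡ a ^ (c + 1) * b ^ (3 ∸ (c + 1))
pbas-2 d refl refl refl = refl

pbas-3K : ∀ K → pbas 2 (0 + K * 3) ≡ suc K * (K * K)
pbas-3K K = trans (pbas-2 (0 + K * 3)
                     (quotient-by-3 _ 0 (suc K) z<s (e₁ K))
                     (quotient-by-3 _ 1 K (s<s z<s) (e₂ K))
                     ([m+kn]%n≡m%n 0 K 3))
                  (e₃ K)
  where
  e₁ : ∀ K → 0 + K * 3 + 1 + 2 ≡ 0 + suc K * 3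
  e₁ = solve-∀
  e₂ : ∀ K → 0 + K * 3 + 1 ≡ 1 + K * 3
  e₂ = solve-∀
  e₃ : ∀ K → suc K * 1 * (K * (K * 1)) ≡ suc K * (K * K)
  e₃ = solve-∀

pbas-3K+1 : ∀ K → pbas 2 (1 + K * 3) ≡ suc K * suc K * K
pbas-3K+1 K = trans (pbas-2 (1 + K * 3)
                       (quotient-by-3 _ 1 (suc K) (s<s z<s) (e₁ K))
                       (quotient-by-3 _ 2 K (s<s (s<s z<s)) (e₂ K))
                       ([m+kn]%n≡m%n 1 K 3))
                    (e₃ K)
  where
  e₁ : ∀ K → 1 + K * 3 + 1 + 2 ≡ 1 + suc K * 3
  e₁ = solve-∀
  e₂ : ∀ K → 1 + K * 3 + 1 ≡ 2 + K * 3
  e₂ = solve-∀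
  e₃ : ∀ K → suc K * (suc K * 1) * (K * 1) ≡ suc K * suc K * K
  e₃ = solve-∀

pbas-3K+2 : ∀ K → pbas 2 (2 + K * 3) ≡ suc K * suc K * suc K
pbas-3K+2 K = trans (pbas-2 (2 + K * 3)
                       (quotient-by-3 _ 2 (suc K) (s<s (s<s z<s)) (e₁ K))
                       (quotient-by-3 _ 0 (suc K) z<s (e₂ K))
                       ([m+kn]%n≡m%n 2 K 3))
                    (e₃ K)
  where
  e₁ : ∀ K → 2 + K * 3 + 1 + 2 ≡ 2 + suc K * 3
  e₁ = solve-∀
  e₂ : ∀ K → 2 + K * 3 + 1 ≡ 0 + suc K * 3
  e₂ = solve-∀
  e₃ : ∀ K → suc K * (suc K * (suc K * 1)) * 1 ≡ suc K * suc K * suc K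
  e₃ = solve-∀

<-by-excess : ∀ {p b} p′ e → p ≡ p′ → b ≡ suc (p′ + e) → p < b
<-by-excess p′ e refl refl = s≤s (m≤m+n p′ e)

bound-3K+c : ∀ K c → c < 3 → 4 ≤ c + K * 3 →
             Admissible 2 (c + K * 3) (boundAux K c) × pbas 2 (c + K * 3) < boundAux K c
bound-3K+c (suc (suc a)) 0 _ _ =
  subst₂ (Admissible 2) (dim≡ a) (colours≡ a) (p²-lower-bound (2 + a) a (3 + a) z<s ≤-refl (n≤1+n _)) ,
  <-by-excess _ (2 + a) (pbas-3K (2 + a)) (excess a)
  where
  dim≡ : ∀ a → 2 + a + a + (3 + a) + 1 ≡ 0 + (2 + a) * 3
  dim≡ = solve-∀
  colours≡ : ∀ a → suc ((2 + a) * (2 + a)) * (3 + a) ≡ ((2 + a) * (2 + a) + 1) * (2 + a + 1)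
  colours≡ = solve-∀
  excess : ∀ a → ((2 + a) * (2 + a) + 1) * (2 + a + 1) ≡ suc ((3 + a) * ((2 + a) * (2 + a)) + (2 + a))
  excess = solve-∀
bound-3K+c (suc a) 1 _ _ =
  subst₂ (Admissible 2) (dim≡ a) (colours≡ a) (p²-lower-bound (suc a) a (2 + a) z<s ≤-refl ≤-refl) ,
  <-by-excess _ (suc a) (pbas-3K+1 (suc a)) (excess a)
  where
  dim≡ : ∀ a → suc a + a + (2 + a) + 1 ≡ 1 + suc a * 3
  dim≡ = solve-∀
  colours≡ : ∀ a → suc (suc a * (2 + a)) * (2 + a) ≡ (suc a * suc a + suc a + 1) * (suc a + 1)
  colours≡ = solve-∀
  excess : ∀ a → (suc a * suc a + suc a + 1) * (suc a + 1) ≡ suc ((2 + a) * (2 + a) * suc a + suc a)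
  excess = solve-∀
bound-3K+c (suc a) 2 _ _ =
  subst₂ (Admissible 2) (dim≡ a) (colours≡ a) (p²-lower-bound (suc a) a (3 + a) z<s (n≤1+n _) (n≤1+n _)) ,
  <-by-excess _ 0 (pbas-3K+2 (suc a)) (excess a)
  where
  dim≡ : ∀ a → suc a + a + (3 + a) + 1 ≡ 2 + suc a * 3
  dim≡ = solve-∀
  colours≡ : ∀ a → suc (suc a * (2 + a)) * (3 + a) ≡ (suc a * suc a + suc a + 1) * (suc a + 2)
  colours≡ = solve-∀
  excess : ∀ a → (suc a * suc a + suc a + 1) * (suc a + 2) ≡ suc ((2 + a) * (2 + a) * (2 + a) + 0)
  excess = solve-∀
bound-3K+c 1 0 _ (s≤s (s≤s (s≤s ())))
bound-3K+c 0 1 _ (s≤s ())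
bound-3K+c 0 2 _ (s≤s (s≤s ()))
bound-3K+c _ (suc (suc (suc _))) (s≤s (s≤s (s≤s ()))) _

theorem1 : (d : ℕ) → 4 ≤ d → pAtLeast 2 d (bound d) × pGreater 2 d (pbas 2 d)
theorem1 d 4≤d = (bound d , ≤-refl , admissible) , (bound d , pbas<bound , admissible)
  where
  d≡ : d % 3 + d / 3 * 3 ≡ d
  d≡ = sym (m≡m%n+[m/n]*n d 3)
  cases : Admissible 2 (d % 3 + d / 3 * 3) (bound d) × pbas 2 (d % 3 + d / 3 * 3) < bound d
  cases = bound-3K+c (d / 3) (d % 3) (m%n<n d 3) (subst (4 ≤_) (sym d≡) 4≤d)
  admissible : Admissible 2 d (bound d)
  admissible = subst (λ e → Admissible 2 e (bound d)) d≡ (proj₁ cases)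
  pbas<bound : pbas 2 d < bound d
  pbas<bound = subst (λ e → pbas 2 e < bound d) d≡ (proj₂ cases)
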